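{- Let $m,n$ be positive integers. Then $H(n,m)=0$ if $m>n$, $H(n,m)=1$ if $m=n$, and $H(n,m)=1$ if $m=1$. In all other cases, i.e. $n>m>1$, \[H(n,m)=\sum_{j=1}^{n-m}H(n-m,j)\binom{m-1}{j-1}.\]
   Context: A composition of a positive integer $n$ into $m$ parts is an ordered tuple $(c_1,\ldots,c_m)$ of positive integers with $c_1+\cdots+c_m=n$. It is headstrong if $c_1\ge c_i$ for all $i$. $H(n,m)$ denotes the number of headstrong compositions of $n$ with exactly $m$ parts. -}

module Defs where

open import Data.Nat using (ℕ; zero; suc; _+_; _≤_; _≤?_; _≟_; _<_)
open import Data.Nat.Properties using (≤-refl)
open import Data.List using (List; []; _∷_; map; concatMap; upTo; length; filter)
open import Data.List.Relation.Unary.All using (All; all?)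
open import Data.Product using (_×_)
open import Relation.Nullary using (Dec)
open import Relation.Nullary.Decidable using (_×-dec_)
open import Relation.Binary.PropositionalEquality using (_≡_)
open import Data.Unit using (⊤; tt)
open import Relation.Nullary using (yes)
open import Data.Nat.ListAction using (sum)
open import Data.List using (applyUpTo)
open import Data.Nat using (_∸_)

tuples : ℕ → ℕ → List (List ℕ)
tuples n zero    = [] ∷ []
tuples n (suc m) = concatMap (λ c → map (c ∷_) (tuples n m)) (map suc (upTo n))

sumL : List ℕ → ℕ
sumL []       = 0
sumL (x ∷ xs) = x + sumL xs

IsComposition : ℕ → List ℕ → Set
IsComposition n cs = All (1 ≤_) cs × sumL cs ≡ n

IsHeadstrong : List ℕ → Set
IsHeadstrong []       = ⊤
IsHeadstrong (c ∷ cs) = All (_≤ c) cs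

isComposition? : ∀ n cs → Dec (IsComposition n cs)
isComposition? n cs = all? (1 ≤?_) cs ×-dec (sumL cs ≟ n)

isHeadstrong? : ∀ cs → Dec (IsHeadstrong cs)
isHeadstrong? []       = yes tt
isHeadstrong? (c ∷ cs) = all? (_≤? c) cs

-- H n m = number of headstrong compositions of n with exactly m parts.
-- Every part of a composition of n lies in {1,…,n}, so enumerating
-- `tuples n m` covers all of them (each exactly once).
H : ℕ → ℕ → ℕ
H n m = length (filter (λ cs → isComposition? n cs ×-dec isHeadstrong? cs) (tuples n m))

-- Σ_{j=a}^{b} f j  (empty if b < a)
sumFromTo : ℕ → ℕ → (ℕ → ℕ) → ℕ
sumFromTo a b f = sum (map f (applyUpTo (λ i → a + i) (suc b ∸ a)))

-- Classify the headstrong compositions of suc k + r into suc k parts by their first part. A first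
-- part 1 forces every part to be 1, impossible when r ≥ 1. For a first part 2 + i, lower each of
-- the other k parts by 1; this leaves k entries in {0,…,1+i} adding up to r ∸ (1 + i). Its j
-- nonzero entries, preceded by 1 + i, form a headstrong composition of r into j + 1 parts, and
-- their positions can be chosen in k C j ways.
module Submission where

open import Defs
open import Data.Nat using (ℕ; _+_; _∸_; _*_; _<_; _≤_; _>_)
open import Data.Nat.Combinatorics using (_C_)
open import Data.Product using (_×_)
open import Relation.Binary.PropositionalEquality using (_≡_)

open import Data.Nat using (zero; suc; z≤n; s≤s; _≟_; _≤?_)
open import Data.Nat.Properties
open import Algebra.Properties.CommutativeSemigroup +-commutativeSemigroup
  using () renaming (interchange to +-interchange)
open import Data.Nat.Combinatorics using (k>n⇒nCk≡0; nCk+nC[k+1]≡[n+1]C[k+1])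
open import Data.Nat.ListAction using (sum)
open import Data.List as List using (List; []; _∷_; map; concatMap; upTo; length; filter; applyUpTo)
open import Data.List.Properties
  using (length-++; filter-++; filter-≐; filter-none; filter-accept; filter-reject; map-upTo)
open import Data.List.Relation.Unary.All as All using (All; []; _∷_; all?)
open import Data.Product using (_,_; proj₂)
open import Data.Bool using (true; false)
open import Function using (_∘_)
open import Relation.Nullary using (yes; no; ¬_; does; contradiction)
open import Relation.Nullary.Decidable using (_×-dec_)
open import Relation.Unary using (Decidable; _∩_; _≐_)
open import Relation.Binary.PropositionalEquality using (refl; sym; trans; cong; cong₂; subst; module ≡-Reasoning)

open ≡-Reasoning

∑ : ℕ → (ℕ → ℕ) → ℕ
∑ zero    f = 0
∑ (suc n) f = f 0 + ∑ n (f ∘ suc)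

infixr 6.5 ∑
syntax ∑ n (λ i → e) = ∑[ i < n ] e

∑-cong : ∀ n {f g : ℕ → ℕ} → (∀ i → i < n → f i ≡ g i) → ∑ n f ≡ ∑ n g
∑-cong zero    f≡g = refl
∑-cong (suc n) f≡g = cong₂ _+_ (f≡g 0 (s≤s z≤n)) (∑-cong n (λ i i<n → f≡g (suc i) (s≤s i<n)))

∑≡0 : ∀ n {f : ℕ → ℕ} → (∀ i → i < n → f i ≡ 0) → ∑ n f ≡ 0
∑≡0 zero    f≡0 = refl
∑≡0 (suc n) f≡0 = cong₂ _+_ (f≡0 0 (s≤s z≤n)) (∑≡0 n (λ i i<n → f≡0 (suc i) (s≤s i<n)))

∑-distrib-+ : ∀ n (f g : ℕ → ℕ) → ∑[ i < n ] (f i + g i) ≡ ∑ n f + ∑ n g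
∑-distrib-+ zero    f g = refl
∑-distrib-+ (suc n) f g =
  trans (cong (f 0 + g 0 +_) (∑-distrib-+ n (f ∘ suc) (g ∘ suc))) (+-interchange (f 0) (g 0) _ _)

*-distribˡ-∑ : ∀ n c (f : ℕ → ℕ) → c * ∑ n f ≡ ∑[ i < n ] c * f i
*-distribˡ-∑ zero    c f = *-zeroʳ c
*-distribˡ-∑ (suc n) c f =
  trans (*-distribˡ-+ c (f 0) _) (cong (c * f 0 +_) (*-distribˡ-∑ n c (f ∘ suc)))

∑-comm : ∀ n m (f : ℕ → ℕ → ℕ) → ∑[ i < n ] ∑[ j < m ] f i j ≡ ∑[ j < m ] ∑[ i < n ] f i j
∑-comm zero    m f = sym (∑≡0 m (λ _ _ → refl))
∑-comm (suc n) m f = begin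
  ∑[ j < m ] f 0 j + ∑[ i < n ] ∑[ j < m ] f (suc i) j ≡⟨ cong (∑[ j < m ] f 0 j +_) (∑-comm n m (f ∘ suc)) ⟩
  ∑[ j < m ] f 0 j + ∑[ j < m ] ∑[ i < n ] f (suc i) j ≡⟨ ∑-distrib-+ m (f 0) _ ⟨
  ∑[ j < m ] (f 0 j + ∑[ i < n ] f (suc i) j)          ∎

∑-split : ∀ a b (f : ℕ → ℕ) → ∑ (a + b) f ≡ ∑ a f + ∑[ i < b ] f (a + i)
∑-split zero    b f = refl
∑-split (suc a) b f = trans (cong (f 0 +_) (∑-split a b (f ∘ suc))) (sym (+-assoc (f 0) _ _))

∑-vanishing : ∀ {a b} (f : ℕ → ℕ) → a ≤ b → (∀ i → a ≤ i → f i ≡ 0) → ∑ b f ≡ ∑ a f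
∑-vanishing {a} {b} f a≤b f≡0 = begin
  ∑ b f                               ≡⟨ cong (λ t → ∑ t f) (m+[n∸m]≡n a≤b) ⟨
  ∑ (a + (b ∸ a)) f                   ≡⟨ ∑-split a (b ∸ a) f ⟩
  ∑ a f + ∑[ i < b ∸ a ] f (a + i)    ≡⟨ cong (∑ a f +_) (∑≡0 (b ∸ a) (λ i _ → f≡0 (a + i) (m≤m+n a i))) ⟩
  ∑ a f + 0                           ≡⟨ +-identityʳ _ ⟩
  ∑ a f                               ∎

sum-map-applyUpTo : ∀ n (g f : ℕ → ℕ) → sum (map f (applyUpTo g n)) ≡ ∑[ i < n ] f (g i)
sum-map-applyUpTo zero    g f = refl
sum-map-applyUpTo (suc n) g f = cong (f (g 0) +_) (sum-map-applyUpTo n (g ∘ suc) f)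

δ : ℕ → ℕ → ℕ
δ zero    zero    = 1
δ zero    (suc _) = 0
δ (suc _) zero    = 0
δ (suc a) (suc b) = δ a b

δ-refl : ∀ a → δ a a ≡ 1
δ-refl zero    = refl
δ-refl (suc a) = δ-refl a

δ-≢ : ∀ {a b} → ¬ a ≡ b → δ a b ≡ 0
δ-≢ {zero}  {zero}  a≢b = contradiction refl a≢b
δ-≢ {zero}  {suc b} a≢b = refl
δ-≢ {suc a} {zero}  a≢b = refl
δ-≢ {suc a} {suc b} a≢b = δ-≢ (a≢b ∘ cong suc)

∑-δ : ∀ {a n} → a < n → ∑[ i < n ] δ i a ≡ 1
∑-δ {zero}  {suc n} _         = cong suc (∑≡0 n (λ _ _ → refl))
∑-δ {suc a} {suc n} (s≤s a<n) = ∑-δ a<n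

pascal-∑ : ∀ k (q : ℕ → ℕ) →
  ∑[ j < suc k ] (k C j) * q j + ∑[ j < suc k ] (k C j) * q (suc j) ≡
  ∑[ j < suc (suc k) ] (suc k C j) * q j
pascal-∑ k q = begin
    ((k C 0) * q 0 + Z) + X
  ≡⟨ +-assoc ((k C 0) * q 0) Z X ⟩
    (k C 0) * q 0 + (Z + X)
  ≡⟨ cong (λ t → (k C 0) * q 0 + (t + X)) (∑-vanishing _ (n≤1+n k) top≡0) ⟨
    (k C 0) * q 0 + (∑[ j < suc k ] (k C suc j) * q (suc j) + X)
  ≡⟨ cong ((k C 0) * q 0 +_) (∑-distrib-+ (suc k) (λ j → (k C suc j) * q (suc j)) (λ j → (k C j) * q (suc j))) ⟨
    (k C 0) * q 0 + ∑[ j < suc k ] ((k C suc j) * q (suc j) + (k C j) * q (suc j))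
  ≡⟨ cong ((k C 0) * q 0 +_) (∑-cong (suc k) (λ j _ → pascal j)) ⟩
    (suc k C 0) * q 0 + ∑[ j < suc k ] (suc k C suc j) * q (suc j)
  ∎
  where
  X Z : ℕ
  X = ∑[ j < suc k ] (k C j) * q (suc j)
  Z = ∑[ j < k ] (k C suc j) * q (suc j)
  top≡0 : ∀ j → k ≤ j → (k C suc j) * q (suc j) ≡ 0
  top≡0 j k≤j = cong (_* q (suc j)) (k>n⇒nCk≡0 (s≤s k≤j))
  pascal : ∀ j → (k C suc j) * q (suc j) + (k C j) * q (suc j) ≡ (suc k C suc j) * q (suc j)
  pascal j = trans (sym (*-distribʳ-+ (q (suc j)) (k C suc j) (k C j)))
                   (cong (_* q (suc j)) (trans (+-comm (k C suc j) _) (nCk+nC[k+1]≡[n+1]C[k+1] k j)))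

count : {A : Set} {P : A → Set} → Decidable P → List A → ℕ
count P? xs = length (filter P? xs)

count-concatMap : {A B : Set} {P : B → Set} (P? : Decidable P) (g : A → List B) (xs : List A) →
                  count P? (concatMap g xs) ≡ sum (map (count P? ∘ g) xs)
count-concatMap P? g []       = refl
count-concatMap P? g (x ∷ xs) = begin
  length (filter P? (g x List.++ concatMap g xs))           ≡⟨ cong length (filter-++ P? (g x) (concatMap g xs)) ⟩
  length (filter P? (g x) List.++ filter P? (concatMap g xs)) ≡⟨ length-++ (filter P? (g x)) ⟩
  count P? (g x) + count P? (concatMap g xs)                ≡⟨ cong (count P? (g x) +_) (count-concatMap P? g xs) ⟩
  count P? (g x) + sum (map (count P? ∘ g) xs)              ∎

count-map : {A B : Set} {P : B → Set} (P? : Decidable P) (g : A → B) (xs : List A) →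
            count P? (map g xs) ≡ count (P? ∘ g) xs
count-map P? g []       = refl
count-map P? g (x ∷ xs) with does (P? (g x))
... | true  = cong suc (count-map P? g xs)
... | false = count-map P? g xs

count-tuples-suc : {P : List ℕ → Set} (P? : Decidable P) (N k : ℕ) →
                   count P? (tuples N (suc k)) ≡ ∑[ i < N ] count (P? ∘ (suc i ∷_)) (tuples N k)
count-tuples-suc P? N k = begin
    count P? (concatMap extend (map suc (upTo N)))
  ≡⟨ count-concatMap P? extend (map suc (upTo N)) ⟩
    sum (map (count P? ∘ extend) (map suc (upTo N)))
  ≡⟨ cong (sum ∘ map (count P? ∘ extend)) (map-upTo suc N) ⟩
    sum (map (count P? ∘ extend) (applyUpTo suc N))
  ≡⟨ sum-map-applyUpTo N suc (count P? ∘ extend) ⟩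
    ∑[ i < N ] count P? (map (suc i ∷_) (tuples N k))
  ≡⟨ ∑-cong N (λ i _ → count-map P? (suc i ∷_) (tuples N k)) ⟩
    ∑[ i < N ] count (P? ∘ (suc i ∷_)) (tuples N k)
  ∎
  where
  extend : ℕ → List (List ℕ)
  extend c = map (c ∷_) (tuples N k)

-- completions n c a k counts the k-tuples with entries in {1,…,c} that raise a partial sum a to n.
completions : (n c a k : ℕ) → ℕ
completions n c a zero    = δ a n
completions n c a (suc k) = ∑[ i < c ] completions n c (a + suc i) k

BoundedCompletion : (n c a : ℕ) → List ℕ → Set
BoundedCompletion n c a cs = All ((1 ≤_) ∩ (_≤ c)) cs × a + sumL cs ≡ n

boundedCompletion? : ∀ n c a → Decidable (BoundedCompletion n c a)
boundedCompletion? n c a cs = all? (λ x → (1 ≤? x) ×-dec (x ≤? c)) cs ×-dec (a + sumL cs ≟ n)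

boundedCompletion-∷ : ∀ {n c a i} → i < c →
                      (BoundedCompletion n c a ∘ (suc i ∷_)) ≐ BoundedCompletion n c (a + suc i)
boundedCompletion-∷ {n} {c} {a} {i} i<c = peel , unpeel
  where
  peel : ∀ {cs} → BoundedCompletion n c a (suc i ∷ cs) → BoundedCompletion n c (a + suc i) cs
  peel {cs} (_ ∷ bounded , sum≡n) = bounded , trans (+-assoc a (suc i) (sumL cs)) sum≡n
  unpeel : ∀ {cs} → BoundedCompletion n c (a + suc i) cs → BoundedCompletion n c a (suc i ∷ cs)
  unpeel {cs} (bounded , sum≡n) = (s≤s z≤n , i<c) ∷ bounded , trans (sym (+-assoc a (suc i) (sumL cs))) sum≡n

boundedCompletion-∷-tooLarge : ∀ {n c a i} → c ≤ i → ∀ cs → ¬ BoundedCompletion n c a (suc i ∷ cs)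
boundedCompletion-∷-tooLarge c≤i cs ((_ , i<c) ∷ _ , _) = ≤⇒≯ c≤i i<c

count-completions : ∀ {N} n c a k → c ≤ N →
                    count (boundedCompletion? n c a) (tuples N k) ≡ completions n c a k
count-completions n c a zero c≤N with a ≟ n
... | yes refl = trans (cong length (filter-accept (boundedCompletion? n c a) {x = []} {xs = []} ([] , +-identityʳ a)))
                       (sym (δ-refl a))
... | no  a≢n  = trans (cong length (filter-reject (boundedCompletion? n c a) {x = []} {xs = []}
                                                 (a≢n ∘ trans (sym (+-identityʳ a)) ∘ proj₂)))
                       (sym (δ-≢ a≢n))
count-completions {N} n c a (suc k) c≤N = begin
    count (boundedCompletion? n c a) (tuples N (suc k))
  ≡⟨ count-tuples-suc (boundedCompletion? n c a) N k ⟩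
    ∑[ i < N ] count (boundedCompletion? n c a ∘ (suc i ∷_)) (tuples N k)
  ≡⟨ ∑-vanishing _ c≤N (λ i c≤i → cong length (filter-none _ (All.universal (boundedCompletion-∷-tooLarge c≤i) (tuples N k)))) ⟩
    ∑[ i < c ] count (boundedCompletion? n c a ∘ (suc i ∷_)) (tuples N k)
  ≡⟨ ∑-cong c (λ i i<c → cong length (filter-≐ _ (boundedCompletion? n c (a + suc i)) (boundedCompletion-∷ i<c) (tuples N k))) ⟩
    ∑[ i < c ] count (boundedCompletion? n c (a + suc i)) (tuples N k)
  ≡⟨ ∑-cong c (λ i _ → count-completions n c (a + suc i) k c≤N) ⟩
    completions n c a (suc k)
  ∎

completions-overshoot : ∀ n c a k → n < a + k → completions n c a k ≡ 0
completions-overshoot n c a zero    n<a+0 = δ-≢ (<⇒≢ (subst (n <_) (+-identityʳ a) n<a+0) ∘ sym)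
completions-overshoot n c a (suc k) n<a+k = ∑≡0 c (λ i _ → completions-overshoot n c (a + suc i) k (<-≤-trans n<a+k (a+k≤ i)))
  where
  a+k≤ : ∀ i → a + suc k ≤ a + suc i + k
  a+k≤ i = ≤-trans (+-monoʳ-≤ a (s≤s (m≤n+m k i))) (≤-reflexive (sym (+-assoc a (suc i) k)))

completions-ones : ∀ n a k → completions n 1 a k ≡ δ (a + k) n
completions-ones n a zero    = cong (λ x → δ x n) (sym (+-identityʳ a))
completions-ones n a (suc k) = begin
  completions n 1 (a + 1) k + 0 ≡⟨ +-identityʳ _ ⟩
  completions n 1 (a + 1) k     ≡⟨ completions-ones n (a + 1) k ⟩
  δ (a + 1 + k) n               ≡⟨ cong (λ x → δ x n) (+-assoc a 1 k) ⟩
  δ (a + suc k) n               ∎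

completions-shift : ∀ n c a k → completions (suc n) c (suc a) k ≡ completions n c a k
completions-shift n c a zero    = refl
completions-shift n c a (suc k) = ∑-cong c (λ i _ → completions-shift n c (a + suc i) k)

-- Lowering each part by 1 leaves entries in {0,…,c}; its j nonzero entries form a tuple counted
-- by completions n c a j, and their positions can be chosen in k C j ways.
completions-strip : ∀ n c a k → completions (n + k) (suc c) a k ≡ ∑[ j < suc k ] (k C j) * completions n c a j
completions-strip n c a zero    = trans (cong (δ a) (+-identityʳ n)) (sym (trans (+-identityʳ _) (*-identityˡ _)))
completions-strip n c a (suc k) = begin
    ∑[ i < suc c ] completions (n + suc k) (suc c) (a + suc i) k
  ≡⟨ ∑-cong (suc c) (λ i _ → cong (λ t → completions t (suc c) (a + suc i) k) (+-suc n k)) ⟩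
    ∑[ i < suc c ] completions (suc n + k) (suc c) (a + suc i) k
  ≡⟨ ∑-cong (suc c) (λ i _ → completions-strip (suc n) c (a + suc i) k) ⟩
    ∑[ i < suc c ] ∑[ j < suc k ] (k C j) * completions (suc n) c (a + suc i) j
  ≡⟨ ∑-cong (suc c) (λ i _ → ∑-cong (suc k) (λ j _ → cong ((k C j) *_) (shift i j))) ⟩
    ∑[ j < suc k ] (k C j) * completions n c (a + 0) j + ∑[ i < c ] ∑[ j < suc k ] (k C j) * completions n c (a + suc i) j
  ≡⟨ cong₂ _+_ (∑-cong (suc k) (λ j _ → cong (λ x → (k C j) * completions n c x j) (+-identityʳ a))) factor ⟩
    ∑[ j < suc k ] (k C j) * completions n c a j + ∑[ j < suc k ] (k C j) * completions n c a (suc j)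
  ≡⟨ pascal-∑ k (completions n c a) ⟩
    ∑[ j < suc (suc k) ] (suc k C j) * completions n c a j
  ∎
  where
  shift : ∀ i j → completions (suc n) c (a + suc i) j ≡ completions n c (a + i) j
  shift i j = trans (cong (λ x → completions (suc n) c x j) (+-suc a i)) (completions-shift n c (a + i) j)
  factor : ∑[ i < c ] ∑[ j < suc k ] (k C j) * completions n c (a + suc i) j ≡
           ∑[ j < suc k ] (k C j) * completions n c a (suc j)
  factor = trans (∑-comm c (suc k) (λ i j → (k C j) * completions n c (a + suc i) j))
                 (∑-cong (suc k) (λ j _ → sym (*-distribˡ-∑ c (k C j) (λ i → completions n c (a + suc i) j))))

headstrong⇔boundedCompletion : ∀ {n i} →
  (λ cs → IsComposition n (suc i ∷ cs) × IsHeadstrong (suc i ∷ cs)) ≐ BoundedCompletion n (suc i) (suc i)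
headstrong⇔boundedCompletion =
    (λ { ((_ ∷ positive , sum≡n) , headstrong) → All.zip (positive , headstrong) , sum≡n })
  , (λ { (bounded , sum≡n) → let (positive , headstrong) = All.unzip bounded
                             in (s≤s z≤n ∷ positive , sum≡n) , headstrong })

H-by-first-part : ∀ n k → H n (suc k) ≡ ∑[ i < n ] completions n (suc i) (suc i) k
H-by-first-part n k = begin
    H n (suc k)
  ≡⟨ count-tuples-suc headstrong? n k ⟩
    ∑[ i < n ] count (headstrong? ∘ (suc i ∷_)) (tuples n k)
  ≡⟨ ∑-cong n (λ i _ → cong length (filter-≐ _ (boundedCompletion? n (suc i) (suc i)) headstrong⇔boundedCompletion (tuples n k))) ⟩
    ∑[ i < n ] count (boundedCompletion? n (suc i) (suc i)) (tuples n k)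
  ≡⟨ ∑-cong n (λ i i<n → count-completions n (suc i) (suc i) k i<n) ⟩
    ∑[ i < n ] completions n (suc i) (suc i) k
  ∎
  where
  headstrong? : Decidable (λ cs → IsComposition n cs × IsHeadstrong cs)
  headstrong? cs = isComposition? n cs ×-dec isHeadstrong? cs

H-tooManyParts : ∀ n k → n ≤ k → H n (suc k) ≡ 0
H-tooManyParts n k n≤k = trans (H-by-first-part n k)
  (∑≡0 n (λ i _ → completions-overshoot n (suc i) (suc i) k (s≤s (≤-trans n≤k (m≤n+m k i)))))

H-onePart : ∀ n → 1 ≤ n → H n 1 ≡ 1
H-onePart (suc n) _ = trans (H-by-first-part (suc n) 0) (∑-δ (n<1+n n))

H-diagonal : ∀ k → H (suc k) (suc k) ≡ 1
H-diagonal k = begin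
    H (suc k) (suc k)
  ≡⟨ H-by-first-part (suc k) k ⟩
    completions (suc k) 1 1 k + ∑[ i < k ] completions (suc k) (2 + i) (2 + i) k
  ≡⟨ cong₂ _+_ (trans (completions-ones (suc k) 1 k) (δ-refl k))
               (∑≡0 k (λ i _ → completions-overshoot (suc k) (2 + i) (2 + i) k (s≤s (s≤s (m≤n+m k i))))) ⟩
    1
  ∎

H-binomial : ∀ r k → 1 ≤ r → H (suc k + r) (suc k) ≡ ∑[ j < suc k ] (k C j) * H r (suc j)
H-binomial r k 1≤r = begin
    H (suc k + r) (suc k)
  ≡⟨ H-by-first-part (suc k + r) k ⟩
    completions (suc k + r) 1 1 k + ∑[ i < k + r ] completions (suc k + r) (2 + i) (2 + i) k
  ≡⟨ cong₂ _+_ (trans (completions-ones (suc k + r) 1 k) (δ-≢ (<⇒≢ (m<m+n k 1≤r))))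
               (∑-cong (k + r) (λ i _ → strip i)) ⟩
    ∑[ i < k + r ] byRest i
  ≡⟨ ∑-vanishing byRest (m≤n+m r k) (λ i r≤i →
       ∑≡0 (suc k) (λ j _ → trans (cong ((k C j) *_) (completions-overshoot r (suc i) (suc i) j (s≤s (≤-trans r≤i (m≤m+n i j)))))
                                  (*-zeroʳ (k C j)))) ⟩
    ∑[ i < r ] byRest i
  ≡⟨ ∑-comm r (suc k) (λ i j → (k C j) * completions r (suc i) (suc i) j) ⟩
    ∑[ j < suc k ] ∑[ i < r ] (k C j) * completions r (suc i) (suc i) j
  ≡⟨ ∑-cong (suc k) (λ j _ → trans (sym (*-distribˡ-∑ r (k C j) (λ i → completions r (suc i) (suc i) j)))
                                   (cong ((k C j) *_) (sym (H-by-first-part r j)))) ⟩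
    ∑[ j < suc k ] (k C j) * H r (suc j)
  ∎
  where
  byRest : ℕ → ℕ
  byRest i = ∑[ j < suc k ] (k C j) * completions r (suc i) (suc i) j
  strip : ∀ i → completions (suc k + r) (2 + i) (2 + i) k ≡ byRest i
  strip i = begin
      completions (suc k + r) (2 + i) (2 + i) k
    ≡⟨ cong (λ t → completions (suc t) (2 + i) (2 + i) k) (+-comm k r) ⟩
      completions (suc r + k) (2 + i) (2 + i) k
    ≡⟨ completions-strip (suc r) (suc i) (2 + i) k ⟩
      ∑[ j < suc k ] (k C j) * completions (suc r) (suc i) (2 + i) j
    ≡⟨ ∑-cong (suc k) (λ j _ → cong ((k C j) *_) (completions-shift r (suc i) (suc i) j)) ⟩
      byRest i
    ∎

H-recurrence : ∀ r k → 1 ≤ r → H (suc k + r) (suc k) ≡ ∑[ j < r ] H r (suc j) * (k C j)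
H-recurrence r k 1≤r = begin
    H (suc k + r) (suc k)
  ≡⟨ H-binomial r k 1≤r ⟩
    ∑[ j < suc k ] (k C j) * H r (suc j)
  ≡⟨ ∑-vanishing _ (m≤m+n (suc k) r) (λ j k<j → cong (_* H r (suc j)) (k>n⇒nCk≡0 k<j)) ⟨
    ∑[ j < suc k + r ] (k C j) * H r (suc j)
  ≡⟨ ∑-vanishing _ (m≤n+m r (suc k)) (λ j r≤j → trans (cong ((k C j) *_) (H-tooManyParts r j r≤j)) (*-zeroʳ (k C j))) ⟩
    ∑[ j < r ] (k C j) * H r (suc j)
  ≡⟨ ∑-cong r (λ j _ → *-comm (k C j) (H r (suc j))) ⟩
    ∑[ j < r ] H r (suc j) * (k C j)
  ∎

mainTheorem9 : (n m : ℕ) → 1 ≤ n → 1 ≤ m →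
    (m > n → H n m ≡ 0) ×
    (m ≡ n → H n m ≡ 1) ×
    (m ≡ 1 → H n m ≡ 1) ×
    (n > m → m > 1 →
      H n m ≡ sumFromTo 1 (n ∸ m) (λ j → H (n ∸ m) j * ((m ∸ 1) C (j ∸ 1))))
mainTheorem9 n (suc k) 1≤n (s≤s z≤n) =
    (λ n<m → H-tooManyParts n k (≤-pred n<m))
  , (λ { refl → H-diagonal k })
  , (λ { refl → H-onePart n 1≤n })
  , λ m<n _ → let r = n ∸ suc k in begin
      H n (suc k)
    ≡⟨ cong (λ t → H t (suc k)) (m+[n∸m]≡n (<⇒≤ m<n)) ⟨
      H (suc k + r) (suc k)
    ≡⟨ H-recurrence r k (m<n⇒0<n∸m m<n) ⟩
      ∑[ j < r ] H r (suc j) * (k C j)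
    ≡⟨ sum-map-applyUpTo r (1 +_) (λ j → H r j * ((suc k ∸ 1) C (j ∸ 1))) ⟨
      sumFromTo 1 r (λ j → H r j * ((suc k ∸ 1) C (j ∸ 1)))
    ∎
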